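{- Let $G=(A,B,E)$ be a bipartite graph with a proper edge coloring $\chi:E\to\{1,\dots,d\}$, $d\ge2$. Then the output $G'=(A,B,E')$ of reversed thinning (for every outcome of the random choices), with colors inherited from $\chi$, contains no fast walk.
   Context: A bipartite graph is a triple $G=(A,B,E)$ with disjoint $A,B$ and $E\subseteq A\times B$, edges written $(x,y)$ with $x\in A$, $y\in B$. A walk of length $m$ is $v_0,\dots,v_m$ with consecutive vertices adjacent and $v_{i-2}\ne v_i$; its coloring is the sequence of colors of its edges. A fast walk is a walk of length 4 (starting in either side) whose coloring $(c_1,c_2,c_3,c_4)$ satisfies $c_2<c_3<c_4\le c_1$. For distinct $a,b\in\{0,1\}^t$, $P(a,b)$ is the first position where they differ; $\{0,1\}^t$ is ordered lexicographically. Reversed thinning: let $t=\lceil(\log_2 d)/2\rceil+1$ and $H$ the set of triples $(a,i,z)$ with $a\in\{0,1\}^t$, $i\in\{2,\dots,t\}$, $z\in\{1,\dots,2^i\}$, $a$ having $0$ in position $i$, ordered by $(a,i,z)<(b,j,s)$ iff $a<b$, or $a=b$ and $i>j$, or $(a,i)=(b,j)$ and $z<s$. A random $F:\{1,\dots,d\}\to H$ is chosen with $F(1)$ uniform among elements whose $a$ has first bit $0$ and $F(k)$ the successor of $F(k-1)$ in $H$. An edge $e$ with $F(\chi(e))=(a,i,z)$ has class $a$ and type $i$. Independent uniform $a_x\in\{0,1\}^t$ are chosen for all vertices. An edge $(x,y)$ of class $a$ and type $i$ is eligible if $a=a_y<a_x$ and $P(a,a_x)=i$. $E'$ consists of the eligible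 edges not adjacent to another eligible edge of the same type. -}

module Defs where

open import Data.Nat using (ℕ; zero; suc; _+_; _^_; _≤_; _<_; ⌈_/2⌉)
open import Data.Nat.Logarithm using (⌈log₂_⌉)
open import Data.Bool using (Bool; true; false)
open import Data.Vec using (Vec; []; _∷_)
open import Data.Fin using (Fin)
open import Data.Product using (Σ; _×_; _,_; proj₁; proj₂; ∃-syntax)
open import Data.Sum using (_⊎_)
open import Data.Empty using (⊥)
open import Relation.Nullary using (¬_)
open import Relation.Binary.PropositionalEquality using (_≡_; _≢_)

-- Binary strings {0,1}^t as Vec Bool t (false = 0, true = 1),
-- positions are 1-indexed as in the paper.

BitAt : ∀ {n} → Vec Bool n → ℕ → Bool → Set
BitAt []       _             _ = ⊥
BitAt (x ∷ xs) zero          _ = ⊥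
BitAt (x ∷ xs) (suc zero)    b = x ≡ b
BitAt (x ∷ xs) (suc (suc i)) b = BitAt xs (suc i) b

FirstDiff : ∀ {n} → Vec Bool n → Vec Bool n → ℕ → Set
FirstDiff []       []       _             = ⊥
FirstDiff (x ∷ xs) (y ∷ ys) zero          = ⊥
FirstDiff (x ∷ xs) (y ∷ ys) (suc zero)    = x ≢ y
FirstDiff (x ∷ xs) (y ∷ ys) (suc (suc i)) = x ≡ y × FirstDiff xs ys (suc i)

LexLt : ∀ {n} → Vec Bool n → Vec Bool n → Set
LexLt []       []       = ⊥
LexLt (x ∷ xs) (y ∷ ys) = (x ≡ false × y ≡ true) ⊎ (x ≡ y × LexLt xs ys)

-- t = ⌈(log₂ d)/2⌉ + 1 ; note ⌈(log₂ d)/2⌉ = ⌈⌈log₂ d⌉/2⌉.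
tOf : ℕ → ℕ
tOf d = ⌈ ⌈log₂ d ⌉ /2⌉ + 1

Triple : ℕ → Set
Triple t = Vec Bool t × ℕ × ℕ

cls : ∀ {t} → Triple t → Vec Bool t
cls (a , _ , _) = a

typ : ∀ {t} → Triple t → ℕ
typ (_ , i , _) = i

InH : ∀ t → Triple t → Set
InH t (a , i , z) = 2 ≤ i × i ≤ t × 1 ≤ z × z ≤ 2 ^ i × BitAt a i false

HLt : ∀ {t} → Triple t → Triple t → Set
HLt (a , i , z) (b , j , s) =
  LexLt a b ⊎ ((a ≡ b × j < i) ⊎ (a ≡ b × i ≡ j × z < s))

IsSucc : ∀ t → Triple t → Triple t → Set
IsSucc t h h' =
  InH t h × InH t h' × HLt h h' ×
  (∀ h'' → InH t h'' → HLt h h'' → HLt h'' h' → ⊥)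

-- F : {1..d} → H is a possible outcome of the random choice of F:
-- F(1) ∈ H has class with first bit 0, F(k+1) is the successor of F(k).
ValidF : (d : ℕ) → (ℕ → Triple (tOf d)) → Set
ValidF d F =
  InH (tOf d) (F 1) × BitAt (cls (F 1)) 1 false ×
  (∀ k → 1 ≤ k → k < d → IsSucc (tOf d) (F k) (F (suc k)))

-- Bipartite graphs G = (A,B,E) with A = Fin nA, B = Fin nB, E ⊆ A × B,
-- and an edge colouring χ (only its values on E matter).

ProperColoring : ∀ {nA nB} → (Fin nA → Fin nB → Set) → ℕ →
                 (Fin nA → Fin nB → ℕ) → Set
ProperColoring {nA} {nB} E d χ =
  (∀ x y → E x y → 1 ≤ χ x y × χ x y ≤ d) ×
  (∀ x y y' → E x y → E x y' → y ≢ y' → χ x y ≢ χ x y') ×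
  (∀ x x' y → E x y → E x' y → x ≢ x' → χ x y ≢ χ x' y)

module ReversedThinning
  {nA nB : ℕ} (E : Fin nA → Fin nB → Set) (d : ℕ) (χ : Fin nA → Fin nB → ℕ)
  (F : ℕ → Triple (tOf d))
  (labA : Fin nA → Vec Bool (tOf d)) (labB : Fin nB → Vec Bool (tOf d)) where

  edgeType : Fin nA → Fin nB → ℕ
  edgeType x y = typ (F (χ x y))

  Eligible : Fin nA → Fin nB → Set
  Eligible x y =
    E x y ×
    cls (F (χ x y)) ≡ labB y ×
    LexLt (cls (F (χ x y))) (labA x) ×
    FirstDiff (cls (F (χ x y))) (labA x) (typ (F (χ x y)))

  E' : Fin nA → Fin nB → Set
  E' x y =
    Eligible x y ×
    (∀ y' → y' ≢ y → Eligible x y' → edgeType x y' ≢ edgeType x y) ×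
    (∀ x' → x' ≢ x → Eligible x' y → edgeType x' y ≢ edgeType x y)

-- Fast walks in a bipartite graph (A , B , E) with colouring χ.
-- A walk of length 4 with coloring (c1,c2,c3,c4), c2 < c3 < c4 ≤ c1,
-- and no immediate backtracking (v_{i-2} ≠ v_i).

FastColoring : ℕ → ℕ → ℕ → ℕ → Set
FastColoring c1 c2 c3 c4 = c2 < c3 × c3 < c4 × c4 ≤ c1

FastWalkFromA : ∀ {nA nB} → (Fin nA → Fin nB → Set) → (Fin nA → Fin nB → ℕ) → Set
FastWalkFromA {nA} {nB} E χ =
  Σ (Fin nA) λ x0 → Σ (Fin nB) λ y1 → Σ (Fin nA) λ x2 →
  Σ (Fin nB) λ y3 → Σ (Fin nA) λ x4 →
    E x0 y1 × E x2 y1 × E x2 y3 × E x4 y3 ×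
    x0 ≢ x2 × y1 ≢ y3 × x2 ≢ x4 ×
    FastColoring (χ x0 y1) (χ x2 y1) (χ x2 y3) (χ x4 y3)

FastWalkFromB : ∀ {nA nB} → (Fin nA → Fin nB → Set) → (Fin nA → Fin nB → ℕ) → Set
FastWalkFromB {nA} {nB} E χ =
  Σ (Fin nB) λ y0 → Σ (Fin nA) λ x1 → Σ (Fin nB) λ y2 →
  Σ (Fin nA) λ x3 → Σ (Fin nB) λ y4 →
    E x1 y0 × E x1 y2 × E x3 y2 × E x3 y4 ×
    y0 ≢ y2 × x1 ≢ x3 × y2 ≢ y4 ×
    FastColoring (χ x1 y0) (χ x1 y2) (χ x3 y2) (χ x3 y4)

HasFastWalk : ∀ {nA nB} → (Fin nA → Fin nB → Set) → (Fin nA → Fin nB → ℕ) → Set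
HasFastWalk E χ = FastWalkFromA E χ ⊎ FastWalkFromB E χ

module Submission where

-- Along the successor chain F the triples F(1) < F(2) < … < F(d)
-- increase in the order of H, so the class of an edge is a weakly
-- increasing function of its colour, and two edges of the same class
-- with colours c < c' have types typ F(c) ≥ typ F(c').  An eligible edge
-- (x,y) has class a_y and type P(a_y, a_x), so its type is fixed by the
-- labels of its endpoints.
--   * Walk x0 y1 x2 y3 x4 :  c2 < c3 ≤ c1 squeezes a_{y1} ≤ a_{y3} ≤ a_{y1};
--     the edges x2y1, x2y3 then have equal types at x2, forbidden in E'.
--   * Walk y0 x1 y2 x3 y4 :  x1y2, x3y2 share class a_{y2}, so
--     j = P(a_{y2},a_{x3}) < i = P(a_{y2},a_{x1}); and a_{y2} ≤ a_{y4} < a_{x1}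
--     forces a_{y4} to share the first i-1 bits of a_{y2}, hence
--     P(a_{y4},a_{x3}) = j: x3y2 and x3y4 have equal types at x3.

open import Defs
open import Data.Nat using (ℕ; suc; _≤_; _<_; s≤s)
open import Data.Nat.Properties using (<-trans; ≤-trans; <-≤-trans; <⇒≤; m≤n⇒m<n∨m≡n)
open import Data.Bool using (Bool)
open import Data.Vec using (Vec; []; _∷_)
open import Data.Fin using (Fin)
open import Data.Product using (_×_; _,_; proj₁; proj₂)
open import Data.Sum using (_⊎_; inj₁; inj₂)
open import Data.Empty using (⊥-elim)
open import Relation.Nullary using (¬_)
open import Relation.Binary.PropositionalEquality
  using (_≡_; refl; sym; trans; cong; subst; subst₂)

LexLe : ∀ {n} → Vec Bool n → Vec Bool n → Set
LexLe a b = LexLt a b ⊎ a ≡ b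

lex-trans : ∀ {n} {a b c : Vec Bool n} → LexLt a b → LexLt b c → LexLt a c
lex-trans {a = []} {[]} {[]} ()
lex-trans {a = x ∷ xs} {y ∷ ys} {w ∷ ws} (inj₁ (refl , refl)) (inj₁ (() , _))
lex-trans {a = x ∷ xs} {y ∷ ys} {w ∷ ws} (inj₁ (refl , refl)) (inj₂ (refl , _)) = inj₁ (refl , refl)
lex-trans {a = x ∷ xs} {y ∷ ys} {w ∷ ws} (inj₂ (refl , _)) (inj₁ q) = inj₁ q
lex-trans {a = x ∷ xs} {y ∷ ys} {w ∷ ws} (inj₂ (refl , p)) (inj₂ (refl , q)) = inj₂ (refl , lex-trans p q)

lex-irrefl : ∀ {n} {a : Vec Bool n} → ¬ LexLt a a
lex-irrefl {a = x ∷ xs} (inj₁ (refl , ()))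
lex-irrefl {a = x ∷ xs} (inj₂ (_ , p)) = lex-irrefl p

lexLe-<-trans : ∀ {n} {a b c : Vec Bool n} → LexLe a b → LexLt b c → LexLt a c
lexLe-<-trans (inj₁ p) q = lex-trans p q
lexLe-<-trans (inj₂ refl) q = q

lexLe-antisym : ∀ {n} {a b : Vec Bool n} → LexLe a b → LexLe b a → a ≡ b
lexLe-antisym _ (inj₂ refl) = refl
lexLe-antisym (inj₂ refl) _ = refl
lexLe-antisym (inj₁ p) (inj₁ q) = ⊥-elim (lex-irrefl (lex-trans p q))

firstDiff-unique : ∀ {n} {a b : Vec Bool n} {i j} → FirstDiff a b i → FirstDiff a b j → i ≡ j
firstDiff-unique {a = []} {[]} ()
firstDiff-unique {a = x ∷ xs} {y ∷ ys} {suc 0} {suc 0} _ _ = refl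
firstDiff-unique {a = x ∷ xs} {y ∷ ys} {suc 0} {suc (suc j)} x≢y (x≡y , _) = ⊥-elim (x≢y x≡y)
firstDiff-unique {a = x ∷ xs} {y ∷ ys} {suc (suc i)} {suc 0} (x≡y , _) x≢y = ⊥-elim (x≢y x≡y)
firstDiff-unique {a = x ∷ xs} {y ∷ ys} {suc (suc i)} {suc (suc j)} (_ , p) (_ , q) =
  cong suc (firstDiff-unique p q)

lex-sandwich-cons : ∀ {n} {x y w : Bool} {xs ys ws : Vec Bool n} → x ≡ y →
  LexLe (x ∷ xs) (w ∷ ws) → LexLt (w ∷ ws) (y ∷ ys) →
  w ≡ x × LexLe xs ws × LexLt ws ys
lex-sandwich-cons refl (inj₁ (inj₁ (refl , refl))) (inj₁ (() , _))
lex-sandwich-cons refl (inj₁ (inj₁ (refl , refl))) (inj₂ (() , _))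
lex-sandwich-cons refl (inj₁ (inj₂ (refl , _))) (inj₁ (refl , ()))
lex-sandwich-cons refl (inj₁ (inj₂ (refl , p))) (inj₂ (_ , q)) = refl , inj₁ p , q
lex-sandwich-cons refl (inj₂ refl) (inj₁ (refl , ()))
lex-sandwich-cons refl (inj₂ refl) (inj₂ (_ , q)) = refl , inj₂ refl , q

-- If b ≤ c < a, then c shares with b the prefix before P(b,a); so any word
-- a' leaving b earlier, at j < P(b,a), also leaves c exactly at j.
firstDiff-sandwich : ∀ {n} {b a a' c : Vec Bool n} {i j} →
  FirstDiff b a i → FirstDiff b a' j → j < i →
  LexLe b c → LexLt c a → FirstDiff c a' j
firstDiff-sandwich {b = []} {[]} ()
firstDiff-sandwich {b = x ∷ xs} {y ∷ ys} {y' ∷ ys'} {w ∷ ws} {suc 0} {suc 0} _ _ (s≤s ())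
firstDiff-sandwich {b = x ∷ xs} {y ∷ ys} {y' ∷ ys'} {w ∷ ws} {suc (suc i)} {suc 0}
  (x≡y , _) x≢y' _ b≤c c<a
  with lex-sandwich-cons x≡y b≤c c<a
... | refl , _ , _ = x≢y'
firstDiff-sandwich {b = x ∷ xs} {y ∷ ys} {y' ∷ ys'} {w ∷ ws} {suc (suc i)} {suc (suc j)}
  (x≡y , p) (x≡y' , q) (s≤s j<i) b≤c c<a
  with lex-sandwich-cons x≡y b≤c c<a
... | refl , bs≤cs , cs<as = x≡y' , firstDiff-sandwich p q j<i bs≤cs cs<as

-- The order on H is transitive (it is lexicographic in (class, reversed type, z)).
HLt-trans : ∀ {t} {h h' h'' : Triple t} → HLt h h' → HLt h' h'' → HLt h h''
HLt-trans {h = a , _ , _} {b , _ , _} {c , _ , _} (inj₁ p) (inj₁ q) = inj₁ (lex-trans p q)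
HLt-trans {h = a , _ , _} {b , _ , _} {c , _ , _} (inj₁ p) (inj₂ (inj₁ (refl , _))) = inj₁ p
HLt-trans {h = a , _ , _} {b , _ , _} {c , _ , _} (inj₁ p) (inj₂ (inj₂ (refl , _))) = inj₁ p
HLt-trans {h = a , _ , _} {b , _ , _} {c , _ , _} (inj₂ (inj₁ (refl , _))) (inj₁ q) = inj₁ q
HLt-trans {h = a , _ , _} {b , _ , _} {c , _ , _} (inj₂ (inj₂ (refl , _))) (inj₁ q) = inj₁ q
HLt-trans {h = a , _ , _} {b , _ , _} {c , _ , _}
  (inj₂ (inj₁ (refl , p))) (inj₂ (inj₁ (refl , q))) = inj₂ (inj₁ (refl , <-trans q p))
HLt-trans {h = a , _ , _} {b , _ , _} {c , _ , _}
  (inj₂ (inj₁ (refl , p))) (inj₂ (inj₂ (refl , refl , _))) = inj₂ (inj₁ (refl , p))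
HLt-trans {h = a , _ , _} {b , _ , _} {c , _ , _}
  (inj₂ (inj₂ (refl , refl , _))) (inj₂ (inj₁ (refl , q))) = inj₂ (inj₁ (refl , q))
HLt-trans {h = a , _ , _} {b , _ , _} {c , _ , _}
  (inj₂ (inj₂ (refl , refl , p))) (inj₂ (inj₂ (refl , refl , q))) = inj₂ (inj₂ (refl , refl , <-trans p q))

HLt⇒classLe : ∀ {t} {h h' : Triple t} → HLt h h' → LexLe (cls h) (cls h')
HLt⇒classLe {h = _ , _ , _} {_ , _ , _} (inj₁ p) = inj₁ p
HLt⇒classLe {h = _ , _ , _} {_ , _ , _} (inj₂ (inj₁ (e , _))) = inj₂ e
HLt⇒classLe {h = _ , _ , _} {_ , _ , _} (inj₂ (inj₂ (e , _))) = inj₂ e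

HLt⇒typeDrop : ∀ {t} {h h' : Triple t} → HLt h h' → cls h ≡ cls h' →
               typ h' < typ h ⊎ typ h ≡ typ h'
HLt⇒typeDrop {h = _ , _ , _} {_ , _ , _} (inj₁ p) refl = ⊥-elim (lex-irrefl p)
HLt⇒typeDrop {h = _ , _ , _} {_ , _ , _} (inj₂ (inj₁ (_ , p))) _ = inj₁ p
HLt⇒typeDrop {h = _ , _ , _} {_ , _ , _} (inj₂ (inj₂ (_ , p , _))) _ = inj₂ p

chain-increasing : ∀ {ℓ r} {X : Set ℓ} {R : X → X → Set r} →
  (∀ {u v w} → R u v → R v w → R u w) →
  (f : ℕ → X) (d : ℕ) → (∀ k → 1 ≤ k → k < d → R (f k) (f (suc k))) →
  ∀ {c c'} → 1 ≤ c → c < c' → c' ≤ d → R (f c) (f c')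
chain-increasing {R = R} R-trans f d step {c} {suc m} 1≤c (s≤s c≤m) m<d
  with m≤n⇒m<n∨m≡n c≤m
... | inj₁ c<m = R-trans (chain-increasing {R = R} R-trans f d step 1≤c c<m (<⇒≤ m<d))
                         (step m (≤-trans 1≤c c≤m) m<d)
... | inj₂ refl = step m 1≤c m<d

-- The argument needs only that colours of edges lie in 1 … d and that F
-- moves to an H-larger triple at each step; the rest of the hypotheses are idle.
module _ {nA nB : ℕ} (E : Fin nA → Fin nB → Set) (d : ℕ) (χ : Fin nA → Fin nB → ℕ)
  (colourRange : ∀ x y → E x y → 1 ≤ χ x y × χ x y ≤ d)
  (F : ℕ → Triple (tOf d))
  (F-succ : ∀ k → 1 ≤ k → k < d → IsSucc (tOf d) (F k) (F (suc k)))
  (labA : Fin nA → Vec Bool (tOf d)) (labB : Fin nB → Vec Bool (tOf d)) where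

  open ReversedThinning E d χ F labA labB

  F-increasing : ∀ {c c'} → 1 ≤ c → c < c' → c' ≤ d → HLt (F c) (F c')
  F-increasing = chain-increasing {R = HLt} HLt-trans F d (λ k 1≤k k<d → proj₁ (proj₂ (proj₂ (F-succ k 1≤k k<d))))

  eligible-class : ∀ {x y} → Eligible x y → cls (F (χ x y)) ≡ labB y
  eligible-class e = proj₁ (proj₂ e)

  eligible-firstDiff : ∀ {x y} → Eligible x y → FirstDiff (labB y) (labA x) (edgeType x y)
  eligible-firstDiff e = subst (λ v → FirstDiff v _ _) (eligible-class e) (proj₂ (proj₂ (proj₂ e)))

  eligible-below : ∀ {x y} → Eligible x y → LexLt (labB y) (labA x)
  eligible-below e = subst (λ v → LexLt v _) (eligible-class e) (proj₁ (proj₂ (proj₂ e)))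

  eligible-sameType : ∀ {x y y'} → Eligible x y → Eligible x y' → labB y ≡ labB y' →
                      edgeType x y ≡ edgeType x y'
  eligible-sameType e e' same =
    firstDiff-unique (eligible-firstDiff e)
                     (subst (λ v → FirstDiff v _ _) (sym same) (eligible-firstDiff e'))

  eligible-labelMono : ∀ {x y x' y'} → Eligible x y → Eligible x' y' → χ x y ≤ χ x' y' →
                       LexLe (labB y) (labB y')
  eligible-labelMono {x} {y} {x'} {y'} e e' c≤c' with m≤n⇒m<n∨m≡n c≤c'
  ... | inj₁ c<c' =
    subst₂ LexLe (eligible-class e) (eligible-class e')
      (HLt⇒classLe (F-increasing (proj₁ (colourRange x y (proj₁ e))) c<c'
                                 (proj₂ (colourRange x' y' (proj₁ e')))))
  ... | inj₂ c≡c' =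
    inj₂ (trans (sym (eligible-class e)) (trans (cong (λ k → cls (F k)) c≡c') (eligible-class e')))

  eligible-typeDrop : ∀ {x x' y} → Eligible x y → Eligible x' y → χ x y < χ x' y →
                      edgeType x' y < edgeType x y ⊎ edgeType x y ≡ edgeType x' y
  eligible-typeDrop {x} {x'} {y} e e' c<c' =
    HLt⇒typeDrop (F-increasing (proj₁ (colourRange x y (proj₁ e))) c<c'
                               (proj₂ (colourRange x' y (proj₁ e'))))
                 (trans (eligible-class e) (sym (eligible-class e')))

  -- In x0 y1 x2 y3 x4 the labels a_{y1}, a_{y3} coincide, so x2y1, x2y3 share a type.
  noFastWalkFromA : ¬ FastWalkFromA E' χ
  noFastWalkFromA (x0 , y1 , x2 , y3 , x4 , e01 , e21 , e23 , e43 , _ , y1≢y3 , _ , c2<c3 , c3<c4 , c4≤c1) =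
    proj₁ (proj₂ e23) y1 y1≢y3 (proj₁ e21) (eligible-sameType (proj₁ e21) (proj₁ e23) a1≡a3)
    where
    a1≡a3 : labB y1 ≡ labB y3
    a1≡a3 = lexLe-antisym (eligible-labelMono (proj₁ e21) (proj₁ e23) (<⇒≤ c2<c3))
                          (eligible-labelMono (proj₁ e23) (proj₁ e01) (<⇒≤ (<-≤-trans c3<c4 c4≤c1)))

  -- In y0 x1 y2 x3 y4 either x1y2, x3y2 share a type, or its drop makes x3y2, x3y4 share one.
  noFastWalkFromB : ¬ FastWalkFromB E' χ
  noFastWalkFromB (y0 , x1 , y2 , x3 , y4 , e10 , e12 , e32 , e34 , _ , x1≢x3 , y2≢y4 , c2<c3 , c3<c4 , c4≤c1)
    with eligible-typeDrop (proj₁ e12) (proj₁ e32) c2<c3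
  ... | inj₂ sameType = proj₂ (proj₂ e32) x1 x1≢x3 (proj₁ e12) sameType
  ... | inj₁ j<i = proj₁ (proj₂ e34) y2 y2≢y4 (proj₁ e32)
                     (firstDiff-unique firstDiff-y4 (eligible-firstDiff (proj₁ e34)))
    where
    a4<ax1 : LexLt (labB y4) (labA x1)
    a4<ax1 = lexLe-<-trans (eligible-labelMono (proj₁ e34) (proj₁ e10) c4≤c1) (eligible-below (proj₁ e10))
    firstDiff-y4 : FirstDiff (labB y4) (labA x3) (edgeType x3 y2)
    firstDiff-y4 = firstDiff-sandwich (eligible-firstDiff (proj₁ e12)) (eligible-firstDiff (proj₁ e32)) j<i
                     (eligible-labelMono (proj₁ e32) (proj₁ e34) (<⇒≤ c3<c4)) a4<ax1

lemma5 : {nA nB : ℕ} (E : Fin nA → Fin nB → Set) (d : ℕ) (χ : Fin nA → Fin nB → ℕ) →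
         2 ≤ d → ProperColoring E d χ →
         (F : ℕ → Triple (tOf d)) → ValidF d F →
         (labA : Fin nA → Vec Bool (tOf d)) (labB : Fin nB → Vec Bool (tOf d)) →
         ¬ HasFastWalk (ReversedThinning.E' E d χ F labA labB) χ
lemma5 E d χ _ (colourRange , _) F (_ , _ , F-succ) labA labB (inj₁ walk) =
  noFastWalkFromA E d χ colourRange F F-succ labA labB walk
lemma5 E d χ _ (colourRange , _) F (_ , _ , F-succ) labA labB (inj₂ walk) =
  noFastWalkFromB E d χ colourRange F F-succ labA labB walk
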